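{- Let $G$ be a finite simple undirected graph with a Kempe-coloring $\mathfrak{C}$, and let $T \subseteq V(G)$ be a separator of $G$. Then $T \cap D \neq \emptyset$ for all but at most one member $D \in \mathfrak{C}$.
   Context: An anticlique of $G$ is a set of pairwise nonadjacent vertices. A coloring of $G$ is a partition of $V(G)$ into (nonempty) anticliques. A coloring $\mathfrak{C}$ of $G$ is a Kempe-coloring if for any two distinct members $A,B \in \mathfrak{C}$ the induced subgraph $G[A \cup B]$ is connected. A separator of $G$ is a set $T \subseteq V(G)$ such that $G - T$ is disconnected (has at least two components). -}

module Defs where

open import Data.Nat using (ℕ)
open import Data.Fin using (Fin)
open import Data.Product using (Σ; ∃; _×_)
open import Data.Sum using (_⊎_)
open import Function using (Surjective)
open import Relation.Nullary using (¬_)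
open import Relation.Binary.PropositionalEquality using (_≡_; _≢_)

record Graph : Set₁ where
  field
    n     : ℕ
    Adj   : Fin n → Fin n → Set
    sym   : ∀ {u v} → Adj u v → Adj v u
    irrefl : ∀ {u} → ¬ Adj u u
open Graph public

VSet : Graph → Set₁
VSet G = Fin (n G) → Set

-- Walks in the induced subgraph G[S] from u to v.
data Walk (G : Graph) (S : VSet G) : Fin (n G) → Fin (n G) → Set where
  stop : ∀ {u} → S u → Walk G S u u
  step : ∀ {u w v} → S u → Adj G u w → Walk G S w v → Walk G S u v

Connected : (G : Graph) → VSet G → Set
Connected G S = (∃ λ v → S v) × (∀ u v → S u → S v → Walk G S u v)

-- T is a separator: G - T has at least two components, i.e. there are two
-- vertices outside T not joined by any walk avoiding T.
Separator : (G : Graph) → VSet G → Set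
Separator G T = ∃ λ u → ∃ λ v → ¬ T u × ¬ T v × ¬ Walk G (λ x → ¬ T x) u v

-- A coloring with k classes: c : V → Fin k surjective (classes nonempty),
-- each class c⁻¹(i) an anticlique. The members of the coloring are the classes.
Class : (G : Graph) {k : ℕ} → (Fin (n G) → Fin k) → Fin k → VSet G
Class G c i v = c v ≡ i

IsColoring : (G : Graph) {k : ℕ} → (Fin (n G) → Fin k) → Set
IsColoring G {k} c = Surjective _≡_ _≡_ c × (∀ u v → c u ≡ c v → ¬ Adj G u v)

IsKempeColoring : (G : Graph) {k : ℕ} → (Fin (n G) → Fin k) → Set
IsKempeColoring G {k} c = IsColoring G c ×
  (∀ i j → i ≢ j → Connected G (λ v → Class G c i v ⊎ Class G c j v))

module Submission where

-- Let T be a separator with vertices u, v in different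
-- components of G - T, and suppose two distinct colour classes C_i, C_j both
-- avoid T.  Then D = C_i ∪ C_j is a connected vertex set inside G - T (Kempe
-- property).  Moreover D dominates G: a vertex x of any other class C_a has a
-- neighbour in C_i, because G[C_a ∪ C_i] is connected and C_a is an
-- anticlique, so the first step of a walk from x into C_i lands in C_i.
-- Hence u and v both have a walk inside G - T to D, and joining these walks
-- through D connects u to v in G - T, a contradiction.  So i ≡ j.

open import Defs
open import Data.Nat using (ℕ)
open import Data.Fin using (Fin; _≟_)
open import Data.Product using (∃; _×_; _,_; proj₁; proj₂)
open import Data.Sum using (_⊎_; inj₁; inj₂)
open import Data.Empty using (⊥-elim)
open import Relation.Nullary using (¬_; yes; no)
open import Relation.Binary.PropositionalEquality using (_≡_; _≢_; refl) renaming (sym to ≡-sym)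

module _ {G : Graph} where

  mapWalk : ∀ {S S' : VSet G} → (∀ x → S x → S' x) →
            ∀ {u v} → Walk G S u v → Walk G S' u v
  mapWalk f (stop s)     = stop (f _ s)
  mapWalk f (step s a w) = step (f _ s) a (mapWalk f w)

  walkHead : ∀ {S : VSet G} {u v} → Walk G S u v → S u
  walkHead (stop s)     = s
  walkHead (step s _ _) = s

  _++ʷ_ : ∀ {S : VSet G} {u v w} → Walk G S u v → Walk G S v w → Walk G S u w
  stop _     ++ʷ q = q
  step s a p ++ʷ q = step s a (p ++ʷ q)

  reverseWalk : ∀ {S : VSet G} {u v} → Walk G S u v → Walk G S v u
  reverseWalk (stop s)     = stop s
  reverseWalk (step s a p) =
    reverseWalk p ++ʷ step (walkHead p) (Graph.sym G a) (stop s)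

  Dominating : VSet G → Set
  Dominating D = ∀ x → D x ⊎ ∃ λ y → D y × Adj G x y

  walkToDominating : ∀ {S D : VSet G} → (∀ x → D x → S x) → Dominating D →
                     ∀ x → S x → ∃ λ y → D y × Walk G S x y
  walkToDominating D⊆S dom x sx with dom x
  ... | inj₁ dx            = x , dx , stop sx
  ... | inj₂ (y , dy , xy) = y , dy , step sx xy (stop (D⊆S y dy))

  joinThroughHub : ∀ {S H : VSet G} → (∀ x → H x → S x) → Connected G H →
                   (∀ x → S x → ∃ λ y → H y × Walk G S x y) →
                   ∀ u v → S u → S v → Walk G S u v
  joinThroughHub H⊆S (_ , hubWalk) toHub u v su sv
    with toHub u su | toHub v sv
  ... | (y , hy , u→y) | (z , hz , v→z) =
    u→y ++ʷ (mapWalk H⊆S (hubWalk y z hy hz) ++ʷ reverseWalk v→z)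

ClassPair : (G : Graph) {k : ℕ} → (Fin (n G) → Fin k) → Fin k → Fin k → VSet G
ClassPair G c i j x = Class G c i x ⊎ Class G c j x

module _ {G : Graph} {k : ℕ} {c : Fin (n G) → Fin k} (kempe : IsKempeColoring G c) where

  -- Every vertex outside class i has a neighbour in class i: the first step
  -- of a walk in G[C_(c x) ∪ C_i] from x to a vertex of C_i cannot stay in
  -- the anticlique C_(c x), so it enters C_i.
  neighbourInClass : ∀ i x → c x ≢ i → ∃ λ y → Class G c i y × Adj G x y
  neighbourInClass i x cx≢i = firstStep walkIntoI cw≡i
    where
      anticlique : ∀ u v → c u ≡ c v → ¬ Adj G u v
      anticlique = proj₂ (proj₁ kempe)
      w : Fin (n G)
      w = proj₁ (proj₁ (proj₁ kempe) i)
      cw≡i : c w ≡ i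
      cw≡i = proj₂ (proj₁ (proj₁ kempe) i) refl
      walkIntoI : Walk G (ClassPair G c (c x) i) x w
      walkIntoI = proj₂ (proj₂ kempe (c x) i cx≢i) x w (inj₁ refl) (inj₂ cw≡i)
      firstStep : ∀ {z} → Walk G (ClassPair G c (c x) i) x z → c z ≡ i →
                  ∃ λ y → Class G c i y × Adj G x y
      firstStep (stop _)      cx≡i = ⊥-elim (cx≢i cx≡i)
      firstStep (step _ xy p) _ with walkHead p
      ... | inj₁ cy≡cx = ⊥-elim (anticlique x _ (≡-sym cy≡cx) xy)
      ... | inj₂ cy≡i  = _ , cy≡i , xy

  kempePairDominates : ∀ i j → Dominating {G} (ClassPair G c i j)
  kempePairDominates i j x with c x ≟ i
  ... | yes cx≡i = inj₁ (inj₁ cx≡i)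
  ... | no cx≢i with neighbourInClass i x cx≢i
  ...   | (y , cy≡i , xy) = inj₂ (y , inj₁ cy≡i , xy)

lemma1 : (G : Graph) (k : ℕ) (c : Fin (n G) → Fin k) (T : VSet G) →
         IsKempeColoring G c → Separator G T →
         ∀ i j → (∀ v → Class G c i v → ¬ T v) → (∀ v → Class G c j v → ¬ T v) → i ≡ j
lemma1 G k c T kempe (u , v , u∉T , v∉T , separated) i j i∉T j∉T with i ≟ j
... | yes i≡j = i≡j
... | no i≢j  = ⊥-elim (separated (joinThroughHub pair⊆G-T (proj₂ kempe i j i≢j)
                                     (walkToDominating pair⊆G-T (kempePairDominates kempe i j))
                                     u v u∉T v∉T))
  where
    pair⊆G-T : ∀ x → ClassPair G c i j x → ¬ T x
    pair⊆G-T x (inj₁ cx≡i) = i∉T x cx≡i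
    pair⊆G-T x (inj₂ cx≡j) = j∉T x cx≡j
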